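{- Let $G$ be a thread graph. Assume that $G$ contains a $2$-connected subgraph $G_0\subseteq G$ and two vertices $u,v\in V(G)$ such that $V(G)=V(G_0)\cup\{u,v\}$, and $u$ and $v$ are pendant vertices (vertices of degree $1$) in $G$. Let $a\in V(G_0)$ be the neighbor of $u$ and $b\in V(G_0)$ the neighbor of $v$, and assume $a\neq b$. Then $\{a,b\}\in E(G)$ and there exist an ordering $\bar v$ of $V(G)$ and a labeling $\mathcal L$ such that $(G,(a,b),\bar v,\mathcal L)$ is a thread block.
   Context: Graphs are finite, simple, undirected. A thread block is a tuple $(G,(a,b),\bar v,\mathcal L)$ consisting of a graph $G$, an edge $\{a,b\}\in E(G)$, an ordering $\bar v=v_1,\ldots,v_n$ of $V(G)$ with $v_1=a$, $v_n=b$, and a labeling $\mathcal L\colon V(G)\to\{\{L\},\{R\},\{L,R\}\}$ with $\mathcal L(v_1)=\{R\}$, $\mathcal L(v_n)=\{L\}$, and for all $1\le i<j\le n$: $\{v_i,v_j\}\in E(G)$ iff $R\in\mathcal L(v_i)$ and $L\in\mathcal L(v_j)$. A connected thread graph is a graph that is either a single vertex or is obtained from a sequence of thread blocks $(G_1,(a_1,b_1),\bar v^1,\mathcal L^1),\ldots,(G_m,(a_m,b_m),\bar v^m,\mathcal L^m)$ (with pairwise disjoint vertex sets) by identifying $b_i$ with $a_{i+1}$ for all $i\in[m-1]$; the resulting path $a_1,\ldots,b_m$ is called a thread. A thread graph is the empty graph or a disjoint union of connected thread graphs. A graph is $2$-connected if it has at least $2$ vertices and cannot be disconnected by removing fewer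 than $2$ vertices. -}

module Defs where

open import Data.Nat using (ℕ; zero; suc; _<_; _≤_; _∸_)
open import Data.Fin using (Fin; toℕ)
open import Data.Bool using (Bool; true; false; _∧_)
open import Data.List using (List; length; filterᵇ; allFin)
open import Data.List.Membership.Propositional using (_∉_)
open import Data.Product using (Σ; _×_; _,_; ∃)
open import Data.Sum using (_⊎_)
open import Function using (_⇔_)
open import Data.Empty using (⊥)
open import Function.Definitions using (Bijective)
open import Relation.Binary.PropositionalEquality using (_≡_)

record Graph (n : ℕ) : Set where
  field
    E     : Fin n → Fin n → Bool
    sym   : ∀ x y → E x y ≡ E y x
    irref : ∀ x → E x x ≡ false
open Graph public

Adj : ∀ {n} → Graph n → Fin n → Fin n → Set
Adj G x y = E G x y ≡ true

deg : ∀ {n} → Graph n → Fin n → ℕ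
deg {n} G u = length (filterᵇ (E G u) (allFin n))

data Label : Set where
  onlyL onlyR LR : Label

hasL : Label → Bool
hasL onlyL = true
hasL onlyR = false
hasL LR    = true

hasR : Label → Bool
hasR onlyL = false
hasR onlyR = true
hasR LR    = true

-- (G,(a,b),v̄,𝓛) is a thread block; the ordering is v_{i+1} = σ i
-- (σ : positions → vertices, a bijection), labeling lab.
record IsThreadBlock {k : ℕ} (G : Graph k) (a b : Fin k)
                     (σ : Fin k → Fin k) (lab : Fin k → Label) : Set where
  field
    edge      : Adj G a b
    ordering  : Bijective _≡_ _≡_ σ
    first     : ∀ i → toℕ i ≡ 0 → σ i ≡ a
    last      : ∀ i → suc (toℕ i) ≡ k → σ i ≡ b
    labFirst  : lab a ≡ onlyR
    labLast   : lab b ≡ onlyL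
    adjacency : ∀ i j → toℕ i < toℕ j →
                E G (σ i) (σ j) ≡ (hasR (lab (σ i)) ∧ hasL (lab (σ j)))

-- Connected thread graphs: a single vertex, or (isomorphic to) the graph
-- obtained from thread blocks B_0,…,B_{m-1} (m ≥ 1, disjoint) by
-- identifying b_i with a_{i+1}.  The maps f i : V(B_i) → V(H) describe
-- the gluing: jointly surjective, identifying exactly the pairs b_i ~ a_{i+1},
-- and the edges of H are exactly the images of the block edges.

record ThreadGluing {k : ℕ} (H : Graph k) : Set₁ where
  field
    m       : ℕ
    nonempty : 1 ≤ m
    size    : Fin m → ℕ
    block   : (i : Fin m) → Graph (size i)
    a b     : (i : Fin m) → Fin (size i)
    order   : (i : Fin m) → Fin (size i) → Fin (size i)
    label   : (i : Fin m) → Fin (size i) → Label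
    isBlock : (i : Fin m) → IsThreadBlock (block i) (a i) (b i) (order i) (label i)
    f       : (i : Fin m) → Fin (size i) → Fin k
    cover   : ∀ w → Σ (Fin m) λ i → Σ (Fin (size i)) λ x → f i x ≡ w
    ident   : ∀ i j (x : Fin (size i)) (y : Fin (size j)) →
              f i x ≡ f j y ⇔
                ( _≡_ {A = Σ (Fin m) (λ l → Fin (size l))} (i , x) (j , y)
                ⊎ (toℕ j ≡ suc (toℕ i) × x ≡ b i × y ≡ a j)
                ⊎ (toℕ i ≡ suc (toℕ j) × x ≡ a i × y ≡ b j))
    edges   : ∀ p q → Adj H p q ⇔
              (Σ (Fin m) λ i → Σ (Fin (size i)) λ x → Σ (Fin (size i)) λ y →
                 f i x ≡ p × f i y ≡ q × Adj (block i) x y)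

ConnectedThreadGraph : ∀ {k} → Graph k → Set₁
ConnectedThreadGraph {k} H = k ≡ 1 ⊎ ThreadGluing H

record ThreadGraph {n : ℕ} (G : Graph n) : Set₁ where
  field
    c      : ℕ
    size   : Fin c → ℕ
    comp   : (j : Fin c) → Graph (size j)
    isConn : (j : Fin c) → ConnectedThreadGraph (comp j)
    g      : (j : Fin c) → Fin (size j) → Fin n
    cover  : ∀ w → Σ (Fin c) λ j → Σ (Fin (size j)) λ x → g j x ≡ w
    inj    : ∀ j j' (x : Fin (size j)) (y : Fin (size j')) → g j x ≡ g j' y →
             _≡_ {A = Σ (Fin c) (λ l → Fin (size l))} (j , x) (j' , y)
    edges  : ∀ p q → Adj G p q ⇔
             (Σ (Fin c) λ j → Σ (Fin (size j)) λ x → Σ (Fin (size j)) λ y →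
                g j x ≡ p × g j y ≡ q × Adj (comp j) x y)

record IsSubgraph {n : ℕ} (G : Graph n) (S : Fin n → Set)
                  (F : Fin n → Fin n → Set) : Set where
  field
    edgeIn  : ∀ x y → F x y → Adj G x y
    endsIn  : ∀ x y → F x y → S x × S y
    symF    : ∀ x y → F x y → F y x

-- walks in (T, F) from x to y all of whose vertices after x lie in T
data Walk {n : ℕ} (T : Fin n → Set) (F : Fin n → Fin n → Set) :
          Fin n → Fin n → Set where
  here : ∀ {x} → Walk T F x x
  step : ∀ {x y z} → F x y → T y → Walk T F y z → Walk T F x z

Connected : ∀ {n} → (Fin n → Set) → (Fin n → Fin n → Set) → Set
Connected T F = ∀ x y → T x → T y → Walk T F x y

record TwoConnected {n : ℕ} (S : Fin n → Set) (F : Fin n → Fin n → Set) : Set where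
  field
    twoVertices : Σ (Fin n) λ x → Σ (Fin n) λ y → S x × S y × (x ≡ y → ⊥)
    robust      : (X : List (Fin n)) → length X < 2 →
                  Connected (λ w → S w × w ∉ X) F

-- Some edge of G₀ lies in a block B of a connected thread component. Two blocks of a
-- thread share at most one vertex, and the vertex shared by consecutive blocks separates
-- the earlier blocks from the later ones; since G₀ stays connected after deleting any
-- single vertex, all of G₀ lies in B. A pendant vertex inside B is adjacent to an end of
-- B, because every vertex of a thread block is adjacent to its first or its last vertex,
-- and a pendant vertex outside B reaches B only through a shared vertex, again an end of B.
-- Hence a and b are the two ends of B, so they are adjacent, and G is a thread block:
-- take the order of B with u inserted right after a (label L) and v right before b
-- (label R).

module Submission where

open import Defs renaming (sym to E-sym)
open import Data.Nat using (ℕ; suc; _+_; _*_; _∸_; _<_; _≤_; z≤n; s≤s; s≤s⁻¹)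
open import Data.Nat.Properties
open import Data.Fin using (Fin; zero; toℕ; fromℕ; fromℕ<; punchOut) renaming (_≟_ to _≟ᶠ_)
open import Data.Fin.Properties
  using (toℕ-injective; toℕ<n; toℕ-fromℕ; toℕ-fromℕ<; any?; punchOut-injective; injective⇒≤)
open import Data.Bool using (true; false; _∧_; T)
open import Data.Bool.Properties using (∧-comm; ¬-not; T?)
open import Data.Empty using (⊥; ⊥-elim)
open import Data.Unit using (⊤; tt)
open import Data.Product using (Σ; ∃; _×_; _,_; proj₁; proj₂)
open import Data.Product.Properties using (,-injectiveˡ; ,-injectiveʳ-UIP)
open import Data.Sum using (_⊎_; inj₁; inj₂; map₁)
open import Data.List using (List; []; _∷_; length; filter; filterᵇ; allFin)
open import Data.List.Properties using (filter-notAll; length-tabulate)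
open import Data.List.Membership.Propositional using (_∈_; _∉_; lose)
open import Data.List.Membership.Propositional.Properties using (∈-allFin; ∈-filter⁺)
open import Data.List.Relation.Unary.Any using (here; there)
open import Function using (_∘_; _$_)
open import Function.Bundles using (Equivalence)
open import Function.Definitions using (Injective; StrictlySurjective; Bijective)
open import Function.Consequences.Propositional using (strictlySurjective⇒surjective)
open import Axiom.UniquenessOfIdentityProofs using (module Decidable⇒UIP)
open import Level using (0ℓ)
open import Relation.Nullary using (¬_; yes; no; contradiction)
open import Relation.Unary using (Pred; Decidable)
open import Relation.Binary using (tri<; tri≈; tri>)
open import Relation.Binary.PropositionalEquality

adjacent⇒distinct : ∀ {n} (G : Graph n) {x y : Fin n} → Adj G x y → x ≢ y
adjacent⇒distinct G {x} x~x refl with trans (sym x~x) (irref G x)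
... | ()

length≡1⇒∈-unique : ∀ {A : Set} {xs : List A} {x y : A} → length xs ≡ 1 → x ∈ xs → y ∈ xs → x ≡ y
length≡1⇒∈-unique {xs = _ ∷ []} _ (here x≡z) (here y≡z) = trans x≡z (sym y≡z)

deg≡1⇒unique-neighbour : ∀ {n} (G : Graph n) {u a q : Fin n} →
                         deg G u ≡ 1 → Adj G u a → Adj G u q → q ≡ a
deg≡1⇒unique-neighbour {n} G {u} deg≡1 u~a u~q =
  length≡1⇒∈-unique deg≡1 (neighbour u~q) (neighbour u~a)
  where
  neighbour : ∀ {p} → Adj G u p → p ∈ filterᵇ (E G u) (allFin n)
  neighbour {p} u~p = ∈-filter⁺ (T? ∘ E G u) (∈-allFin p) (subst T (sym u~p) tt)

walk-preserves : ∀ {n} {T : Fin n → Set} {F : Fin n → Fin n → Set} (P : Fin n → Set) →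
                 (∀ {x y} → F x y → T y → P x → P y) → ∀ {p q} → Walk T F p q → P p → P q
walk-preserves P closed here          Pp = Pp
walk-preserves P closed (step f Ty w) Pp = walk-preserves P closed w (closed f Ty Pp)

≢⇒∉[_] : ∀ {n} {x : Fin n} w → x ≢ w → x ∉ w ∷ []
≢⇒∉[ w ] x≢w (here x≡w) = x≢w x≡w

one-avoids : ∀ {n} {P : Fin n → Set} {x y} → P x → P y → x ≢ y → ∀ w → ∃ λ p → P p × p ≢ w
one-avoids {x = x} {y} Px Py x≢y w with x ≟ᶠ w
... | yes x≡w = y , Py , λ y≡w → x≢y (trans x≡w (sym y≡w))
... | no x≢w  = x , Px , x≢w

edge-of-two-connected : ∀ {n} {S : Fin n → Set} {F : Fin n → Fin n → Set} → TwoConnected S F →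
                        ∃ λ x → ∃ λ y → S x × S y × F x y
edge-of-two-connected S-2conn
  with x , y , Sx , Sy , x≢y ← TwoConnected.twoVertices S-2conn
  with TwoConnected.robust S-2conn [] (s≤s z≤n) x y (Sx , λ ()) (Sy , λ ())
... | here                           = contradiction refl x≢y
... | step {y = y′} x~y′ (Sy′ , _) _ = x , y′ , Sx , Sy′ , x~y′

-- Sorting by an injective key

module _ {A : Set} {P Q : Pred A 0ℓ} (P? : Decidable P) (Q? : Decidable Q)
         (P⇒Q : ∀ {x} → P x → Q x) where

  length-filter-mono : ∀ xs → length (filter P? xs) ≤ length (filter Q? xs)
  length-filter-mono []       = z≤n
  length-filter-mono (y ∷ xs) with P? y | Q? y
  ... | yes _  | yes _  = s≤s (length-filter-mono xs)
  ... | yes py | no ¬qy = contradiction (P⇒Q py) ¬qy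
  ... | no _   | yes _  = m≤n⇒m≤1+n (length-filter-mono xs)
  ... | no _   | no _   = length-filter-mono xs

  length-filter-strict : ∀ {x xs} → x ∈ xs → Q x → ¬ P x →
                         length (filter P? xs) < length (filter Q? xs)
  length-filter-strict {xs = y ∷ xs} (here refl) qx ¬px with P? y | Q? y
  ... | yes py | _      = contradiction py ¬px
  ... | no _   | yes _  = s≤s (length-filter-mono xs)
  ... | no _   | no ¬qy = contradiction qx ¬qy
  length-filter-strict {xs = y ∷ xs} (there x∈xs) qx ¬px with P? y | Q? y
  ... | yes _  | yes _  = s≤s (length-filter-strict x∈xs qx ¬px)
  ... | yes py | no ¬qy = contradiction (P⇒Q py) ¬qy
  ... | no _   | yes _  = m<n⇒m<1+n (length-filter-strict x∈xs qx ¬px)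
  ... | no _   | no _   = length-filter-strict x∈xs qx ¬px

injective⇒strictlySurjective : ∀ {n} {f : Fin n → Fin n} →
                               Injective _≡_ _≡_ f → StrictlySurjective _≡_ f
injective⇒strictlySurjective {suc n} {f} f-injective y with any? (λ x → f x ≟ᶠ y)
... | yes hit = hit
... | no miss = contradiction (injective⇒≤ squeezed-injective) 1+n≰n
  where
  avoids : ∀ x → y ≢ f x
  avoids x y≡fx = miss (x , sym y≡fx)
  squeezed : Fin (suc n) → Fin n
  squeezed x = punchOut (avoids x)
  squeezed-injective : Injective _≡_ _≡_ squeezed
  squeezed-injective eq = f-injective (punchOut-injective (avoids _) (avoids _) eq)

module SortBy {n : ℕ} (key : Fin n → ℕ) (key-injective : Injective _≡_ _≡_ key) where

  rank : Fin n → ℕ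
  rank p = length (filter (λ q → key q <? key p) (allFin n))

  rank<n : ∀ p → rank p < n
  rank<n p = subst (rank p <_) (length-tabulate (λ i → i))
    (filter-notAll (λ q → key q <? key p) (allFin n) (lose (∈-allFin p) (n≮n _)))

  rank-strictly-monotone : ∀ {p q} → key p < key q → rank p < rank q
  rank-strictly-monotone {p} {q} kp<kq =
    length-filter-strict (λ r → key r <? key p) (λ r → key r <? key q)
      (λ kr<kp → <-trans kr<kp kp<kq) (∈-allFin p) kp<kq (n≮n _)

  rank-injective : Injective _≡_ _≡_ rank
  rank-injective {p} {q} eq with <-cmp (key p) (key q)
  ... | tri< lt _ _ = contradiction eq (<⇒≢ (rank-strictly-monotone lt))
  ... | tri≈ _ e _  = key-injective e
  ... | tri> _ _ gt = contradiction (sym eq) (<⇒≢ (rank-strictly-monotone gt))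

  position : Fin n → Fin n
  position p = fromℕ< (rank<n p)

  toℕ-position : ∀ p → toℕ (position p) ≡ rank p
  toℕ-position p = toℕ-fromℕ< (rank<n p)

  position-injective : Injective _≡_ _≡_ position
  position-injective {p} {q} eq =
    rank-injective (trans (sym (toℕ-position p)) (trans (cong toℕ eq) (toℕ-position q)))

  sorted : Fin n → Fin n
  sorted i = proj₁ (injective⇒strictlySurjective position-injective i)

  position-sorted : ∀ i → position (sorted i) ≡ i
  position-sorted i = proj₂ (injective⇒strictlySurjective position-injective i)

  sorted-position : ∀ p → sorted (position p) ≡ p
  sorted-position p = position-injective (position-sorted (position p))

  sorted-bijective : Bijective _≡_ _≡_ sorted
  sorted-bijective =
    sorted-injective , strictlySurjective⇒surjective (λ p → position p , sorted-position p)
    where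
    sorted-injective : Injective _≡_ _≡_ sorted
    sorted-injective {i} {j} eq =
      trans (sym (position-sorted i)) (trans (cong position eq) (position-sorted j))

  rank-sorted : ∀ i → rank (sorted i) ≡ toℕ i
  rank-sorted i = trans (sym (toℕ-position (sorted i))) (cong toℕ (position-sorted i))

  sorted-monotone : ∀ {i j} → toℕ i ≤ toℕ j → key (sorted i) ≤ key (sorted j)
  sorted-monotone {i} {j} i≤j = ≮⇒≥ λ kj<ki →
    ≤⇒≯ i≤j (subst₂ _<_ (rank-sorted j) (rank-sorted i) (rank-strictly-monotone kj<ki))

  sorted-strictly-monotone : ∀ {i j} → toℕ i < toℕ j → key (sorted i) < key (sorted j)
  sorted-strictly-monotone {i} {j} i<j = ≤∧≢⇒< (sorted-monotone (<⇒≤ i<j))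
    λ eq → <⇒≢ i<j (cong toℕ (proj₁ sorted-bijective (key-injective eq)))

-- Layouts

swap : Label → Label
swap onlyL = onlyR
swap onlyR = onlyL
swap LR    = LR

hasR-swap : ∀ l → hasR (swap l) ≡ hasL l
hasR-swap onlyL = refl
hasR-swap onlyR = refl
hasR-swap LR    = refl

hasL-swap : ∀ l → hasL (swap l) ≡ hasR l
hasL-swap onlyL = refl
hasL-swap onlyR = refl
hasL-swap LR    = refl

ThreadBlockable : ∀ {n} → Graph n → Fin n → Fin n → Set
ThreadBlockable {n} G a b = Σ (Fin n → Fin n) λ σ → Σ (Fin n → Label) λ lab → IsThreadBlock G a b σ lab

-- The thread-block conditions on the vertices in D, with the ordering replaced by an
-- injective ℕ-valued key; unlike a bijection with positions, keys survive inserting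
-- vertices and reversing, and sorting by the key recovers a thread block.
record Layout {n : ℕ} (G : Graph n) (D : Fin n → Set) (a b : Fin n) : Set where
  field
    key           : Fin n → ℕ
    label         : Fin n → Label
    start∈        : D a
    end∈          : D b
    key-injective : ∀ {x y} → D x → D y → key x ≡ key y → x ≡ y
    start-least   : ∀ {x} → D x → x ≢ a → key a < key x
    end-greatest  : ∀ {x} → D x → x ≢ b → key x < key b
    label-start   : label a ≡ onlyR
    label-end     : label b ≡ onlyL
    adjacency     : ∀ {x y} → D x → D y → key x < key y →
                    E G x y ≡ hasR (label x) ∧ hasL (label y)

  start≢end : a ≢ b
  start≢end refl with trans (sym label-start) label-end
  ... | ()

  key-start<key-end : key a < key b
  key-start<key-end = start-least end∈ (λ b≡a → start≢end (sym b≡a))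

  adjacent-start-end : Adj G a b
  adjacent-start-end = trans (adjacency start∈ end∈ key-start<key-end)
                             (cong₂ (λ l l′ → hasR l ∧ hasL l′) label-start label-end)

  key≤key-end : ∀ {x} → D x → key x ≤ key b
  key≤key-end {x} x∈ with x ≟ᶠ b
  ... | yes refl = ≤-refl
  ... | no x≢b   = <⇒≤ (end-greatest x∈ x≢b)

  adjacent-to-start : ∀ {x} → D x → x ≢ a → hasL (label x) ≡ true → Adj G x a
  adjacent-to-start {x} x∈ x≢a hasL-x = begin
    E G x a                         ≡⟨ E-sym G x a ⟩
    E G a x                         ≡⟨ adjacency start∈ x∈ (start-least x∈ x≢a) ⟩
    hasR (label a) ∧ hasL (label x) ≡⟨ cong₂ (λ l t → hasR l ∧ t) label-start hasL-x ⟩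
    true                            ∎
    where open ≡-Reasoning

  adjacent-to-end : ∀ {x} → D x → x ≢ b → hasR (label x) ≡ true → Adj G x b
  adjacent-to-end {x} x∈ x≢b hasR-x = begin
    E G x b                         ≡⟨ adjacency x∈ end∈ (end-greatest x∈ x≢b) ⟩
    hasR (label x) ∧ hasL (label b) ≡⟨ cong₂ (λ t l → t ∧ hasL l) hasR-x label-end ⟩
    true                            ∎
    where open ≡-Reasoning

  adjacent-to-an-end : ∀ {x} → D x → Adj G x a ⊎ Adj G x b
  adjacent-to-an-end {x} x∈ with x ≟ᶠ a | x ≟ᶠ b
  ... | yes refl | _        = inj₂ adjacent-start-end
  ... | no _     | yes refl = inj₁ (trans (E-sym G b a) adjacent-start-end)
  ... | no x≢a   | no x≢b   with label x in lx
  ...   | onlyL = inj₁ (adjacent-to-start x∈ x≢a (cong hasL lx))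
  ...   | LR    = inj₁ (adjacent-to-start x∈ x≢a (cong hasL lx))
  ...   | onlyR = inj₂ (adjacent-to-end x∈ x≢b (cong hasR lx))

reverse : ∀ {n} {G : Graph n} {D : Fin n → Set} {a b : Fin n} → Layout G D a b → Layout G D b a
reverse {G = G} {D} {a} {b} L = record
  { key           = λ x → key b ∸ key x
  ; label         = λ x → swap (label x)
  ; start∈        = end∈
  ; end∈          = start∈
  ; key-injective = λ x∈ y∈ eq →
                      key-injective x∈ y∈ (∸-cancelˡ-≡ (key≤key-end x∈) (key≤key-end y∈) eq)
  ; start-least   = λ x∈ x≢b → ∸-monoʳ-< (end-greatest x∈ x≢b) ≤-refl
  ; end-greatest  = λ x∈ x≢a → ∸-monoʳ-< (start-least x∈ x≢a) (key≤key-end x∈)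
  ; label-start   = cong swap label-end
  ; label-end     = cong swap label-start
  ; adjacency     = reversed-adjacency
  }
  where
  open Layout L
  reversed-adjacency : ∀ {x y} → D x → D y → key b ∸ key x < key b ∸ key y →
                       E G x y ≡ hasR (swap (label x)) ∧ hasL (swap (label y))
  reversed-adjacency {x} {y} x∈ y∈ lt = begin
    E G x y                                       ≡⟨ E-sym G x y ⟩
    E G y x                                       ≡⟨ adjacency y∈ x∈ (∸-cancelʳ-< lt) ⟩
    hasR (label y) ∧ hasL (label x)               ≡⟨ ∧-comm (hasR (label y)) _ ⟩
    hasL (label x) ∧ hasR (label y)               ≡⟨ sym (cong₂ _∧_ (hasR-swap (label x))
                                                                    (hasL-swap (label y))) ⟩
    hasR (swap (label x)) ∧ hasL (swap (label y)) ∎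
    where open ≡-Reasoning

oriented : ∀ {n} {G : Graph n} {D : Fin n → Set} {s e a b : Fin n} → Layout G D s e →
           a ≡ s ⊎ a ≡ e → b ≡ s ⊎ b ≡ e → a ≢ b → Layout G D a b
oriented L (inj₁ refl) (inj₂ refl) _   = L
oriented L (inj₂ refl) (inj₁ refl) _   = reverse L
oriented L (inj₁ refl) (inj₁ refl) a≢b = contradiction refl a≢b
oriented L (inj₂ refl) (inj₂ refl) a≢b = contradiction refl a≢b

odd<even : ∀ {m n} → m < n → suc (2 * m) < 2 * n
odd<even {m} m<n = ≤-trans (s≤s (≤-reflexive (sym (+-suc m (m + 0))))) (*-monoʳ-≤ 2 m<n)

-- Doubling the keys leaves the odd key 2 · key a + 1, right after a, free for u.
module _ {n : ℕ} {G : Graph n} {D : Fin n → Set} {a b : Fin n} (L : Layout G D a b)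
         {u : Fin n} (u~a : Adj G u a) (u-pendant : ∀ {q} → Adj G u q → q ≡ a) (u≢b : u ≢ b) where

  open Layout L

  private
    D⁺ : Fin n → Set
    D⁺ x = D x ⊎ x ≡ u

    key⁺ : Fin n → ℕ
    key⁺ x with x ≟ᶠ u
    ... | yes _ = suc (2 * key a)
    ... | no _  = 2 * key x

    label⁺ : Fin n → Label
    label⁺ x with x ≟ᶠ u
    ... | yes _ = onlyL
    ... | no _  = label x

    key⁺-new : key⁺ u ≡ suc (2 * key a)
    key⁺-new with u ≟ᶠ u
    ... | yes _  = refl
    ... | no u≢u = contradiction refl u≢u

    key⁺-old : ∀ {x} → x ≢ u → key⁺ x ≡ 2 * key x
    key⁺-old {x} x≢u with x ≟ᶠ u
    ... | yes x≡u = contradiction x≡u x≢u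
    ... | no _    = refl

    label⁺-new : label⁺ u ≡ onlyL
    label⁺-new with u ≟ᶠ u
    ... | yes _  = refl
    ... | no u≢u = contradiction refl u≢u

    label⁺-old : ∀ {x} → x ≢ u → label⁺ x ≡ label x
    label⁺-old {x} x≢u with x ≟ᶠ u
    ... | yes x≡u = contradiction x≡u x≢u
    ... | no _    = refl

    a≢u : a ≢ u
    a≢u a≡u = adjacent⇒distinct G u~a (sym a≡u)

    b≢u : b ≢ u
    b≢u b≡u = u≢b (sym b≡u)

    key⁺-start : key⁺ a ≡ 2 * key a
    key⁺-start = key⁺-old a≢u

    new-or-old : ∀ x → x ≡ u ⊎ x ≢ u
    new-or-old x with x ≟ᶠ u
    ... | yes x≡u = inj₁ x≡u
    ... | no x≢u  = inj₂ x≢u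

    old : ∀ {x} → D⁺ x → x ≢ u → D x
    old (inj₁ x∈)  _   = x∈
    old (inj₂ x≡u) x≢u = contradiction x≡u x≢u

    key⁺-injective : ∀ {x y} → D⁺ x → D⁺ y → key⁺ x ≡ key⁺ y → x ≡ y
    key⁺-injective {x} {y} x∈ y∈ eq with new-or-old x | new-or-old y
    ... | inj₁ refl | inj₁ refl = refl
    ... | inj₁ refl | inj₂ y≢u  = contradiction (trans (sym (key⁺-old y≢u)) (trans (sym eq) key⁺-new))
                                                (even≢odd (key y) (key a))
    ... | inj₂ x≢u  | inj₁ refl = contradiction (trans (sym (key⁺-old x≢u)) (trans eq key⁺-new))
                                                (even≢odd (key x) (key a))
    ... | inj₂ x≢u  | inj₂ y≢u  = key-injective (old x∈ x≢u) (old y∈ y≢u)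
      (*-cancelˡ-≡ _ _ 2 (trans (sym (key⁺-old x≢u)) (trans eq (key⁺-old y≢u))))

    start-least⁺ : ∀ {x} → D⁺ x → x ≢ a → key⁺ a < key⁺ x
    start-least⁺ {x} x∈ x≢a with new-or-old x
    ... | inj₁ refl = subst₂ _<_ (sym key⁺-start) (sym key⁺-new) (n<1+n _)
    ... | inj₂ x≢u  = subst₂ _<_ (sym key⁺-start) (sym (key⁺-old x≢u))
                             (*-monoʳ-< 2 (start-least (old x∈ x≢u) x≢a))

    end-greatest⁺ : ∀ {x} → D⁺ x → x ≢ b → key⁺ x < key⁺ b
    end-greatest⁺ {x} x∈ x≢b with new-or-old x
    ... | inj₁ refl = subst₂ _<_ (sym key⁺-new) (sym (key⁺-old b≢u)) (odd<even key-start<key-end)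
    ... | inj₂ x≢u  = subst₂ _<_ (sym (key⁺-old x≢u)) (sym (key⁺-old b≢u))
                             (*-monoʳ-< 2 (end-greatest (old x∈ x≢u) x≢b))

    below-new⇒start : ∀ {x} → D⁺ x → x ≢ u → key⁺ x < key⁺ u → x ≡ a
    below-new⇒start {x} x∈ x≢u lt with x ≟ᶠ a
    ... | yes x≡a = x≡a
    ... | no x≢a  = contradiction (*-cancelˡ-≤ 2 (s≤s⁻¹ (subst₂ _<_ (key⁺-old x≢u) key⁺-new lt)))
                                  (<⇒≱ (start-least (old x∈ x≢u) x≢a))

    labels⁺-old : ∀ {x y} → x ≢ u → y ≢ u →
                  hasR (label x) ∧ hasL (label y) ≡ hasR (label⁺ x) ∧ hasL (label⁺ y)
    labels⁺-old x≢u y≢u = sym (cong₂ (λ l l′ → hasR l ∧ hasL l′) (label⁺-old x≢u) (label⁺-old y≢u))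

    adjacency⁺ : ∀ {x y} → D⁺ x → D⁺ y → key⁺ x < key⁺ y →
                 E G x y ≡ hasR (label⁺ x) ∧ hasL (label⁺ y)
    adjacency⁺ {x} {y} x∈ y∈ lt with new-or-old x | new-or-old y
    ... | inj₁ refl | inj₁ refl = contradiction lt (n≮n _)
    ... | inj₁ refl | inj₂ y≢u  = begin
      E G u y                           ≡⟨ ¬-not (λ u~y → y≢a (u-pendant u~y)) ⟩
      false                             ≡⟨⟩
      hasR onlyL ∧ hasL (label⁺ y)      ≡⟨ cong (λ l → hasR l ∧ hasL (label⁺ y)) (sym label⁺-new) ⟩
      hasR (label⁺ u) ∧ hasL (label⁺ y) ∎
      where
      open ≡-Reasoning
      y≢a : y ≢ a
      y≢a refl = <-asym lt (subst₂ _<_ (sym key⁺-start) (sym key⁺-new) (n<1+n _))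
    ... | inj₂ x≢u  | inj₁ refl with refl ← below-new⇒start x∈ x≢u lt = begin
      E G a u                           ≡⟨ trans (E-sym G a u) u~a ⟩
      true                              ≡⟨ sym (cong₂ (λ l l′ → hasR l ∧ hasL l′) label-start label⁺-new) ⟩
      hasR (label a) ∧ hasL (label⁺ u)  ≡⟨ cong (λ l → hasR l ∧ hasL (label⁺ u))
                                                 (sym (label⁺-old a≢u)) ⟩
      hasR (label⁺ a) ∧ hasL (label⁺ u) ∎
      where open ≡-Reasoning
    ... | inj₂ x≢u  | inj₂ y≢u  = trans
      (adjacency (old x∈ x≢u) (old y∈ y≢u)
        (*-cancelˡ-< 2 _ _ (subst₂ _<_ (key⁺-old x≢u) (key⁺-old y≢u) lt)))
      (labels⁺-old x≢u y≢u)

  insert-after-start : Layout G (λ x → D x ⊎ x ≡ u) a b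
  insert-after-start = record
    { key           = key⁺
    ; label         = label⁺
    ; start∈        = inj₁ start∈
    ; end∈          = inj₁ end∈
    ; key-injective = key⁺-injective
    ; start-least   = start-least⁺
    ; end-greatest  = end-greatest⁺
    ; label-start   = trans (label⁺-old a≢u) label-start
    ; label-end     = trans (label⁺-old b≢u) label-end
    ; adjacency     = adjacency⁺
    }

insert-before-end : ∀ {n} {G : Graph n} {D : Fin n → Set} {a b v : Fin n} → Layout G D a b →
                    Adj G v b → (∀ {q} → Adj G v q → q ≡ b) → v ≢ a →
                    Layout G (λ x → D x ⊎ x ≡ v) a b
insert-before-end L v~b v-pendant v≢a = reverse (insert-after-start (reverse L) v~b v-pendant v≢a)

layout⇒threadBlockable : ∀ {n} {G : Graph n} {D : Fin n → Set} {a b : Fin n} →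
                         Layout G D a b → (∀ x → D x) → ThreadBlockable G a b
layout⇒threadBlockable {n} {G} {D} {a} {b} L total = sorted , label , record
  { edge      = adjacent-start-end
  ; ordering  = sorted-bijective
  ; first     = first
  ; last      = last
  ; labFirst  = label-start
  ; labLast   = label-end
  ; adjacency = λ i j i<j → adjacency (total _) (total _) (sorted-strictly-monotone i<j)
  }
  where
  open Layout L
  open SortBy key (key-injective (total _) (total _))
  first : ∀ i → toℕ i ≡ 0 → sorted i ≡ a
  first i i≡0 with sorted i ≟ᶠ a
  ... | yes σi≡a = σi≡a
  ... | no σi≢a  = contradiction
    (subst (key (sorted i) ≤_) (cong key (sorted-position a))
      (sorted-monotone (subst (_≤ _) (sym i≡0) z≤n)))
    (<⇒≱ (start-least (total _) σi≢a))
  last : ∀ i → suc (toℕ i) ≡ n → sorted i ≡ b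
  last i i≡n-1 with sorted i ≟ᶠ b
  ... | yes σi≡b = σi≡b
  ... | no σi≢b  = contradiction
    (subst (_≤ key (sorted i)) (cong key (sorted-position b))
      (sorted-monotone (s≤s⁻¹ (subst (toℕ (position b) <_) (sym i≡n-1) (toℕ<n (position b))))))
    (<⇒≱ (end-greatest (total _) σi≢b))

complete-with-pendants : ∀ {n} {G : Graph n} {D : Fin n → Set} {a b u v : Fin n} → Layout G D a b →
                         Adj G u a → (∀ {q} → Adj G u q → q ≡ a) →
                         Adj G v b → (∀ {q} → Adj G v q → q ≡ b) →
                         (∀ w → D w ⊎ (w ≡ u ⊎ w ≡ v)) → ThreadBlockable G a b
complete-with-pendants {G = G} {D} {a} {b} {u} {v} L u~a u-pendant v~b v-pendant cover with u ≟ᶠ b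
-- u ≡ b forces v ≡ a, so both pendants are already ends of the layout
... | yes refl = layout⇒threadBlockable L total
  where
  open Layout L
  total : ∀ w → D w
  total w with cover w
  ... | inj₁ w∈          = w∈
  ... | inj₂ (inj₁ refl) = end∈
  ... | inj₂ (inj₂ refl) = subst D (sym (u-pendant (trans (E-sym G u v) v~b))) start∈
... | no u≢b = layout⇒threadBlockable
                 (insert-before-end (insert-after-start L u~a u-pendant u≢b) v~b v-pendant v≢a) total
  where
  v≢a : v ≢ a
  v≢a refl = u≢b (v-pendant (trans (E-sym G v u) u~a))
  total : ∀ w → (D w ⊎ w ≡ u) ⊎ w ≡ v
  total w with cover w
  ... | inj₁ w∈         = inj₁ (inj₁ w∈)
  ... | inj₂ (inj₁ w≡u) = inj₁ (inj₂ w≡u)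
  ... | inj₂ (inj₂ w≡v) = inj₂ w≡v

index-zero : ∀ {N} → Fin N → ∃ λ (i : Fin N) → toℕ i ≡ 0
index-zero {suc N} _ = zero , refl

index-last : ∀ {N} → Fin N → ∃ λ (i : Fin N) → suc (toℕ i) ≡ N
index-last {suc N} _ = fromℕ N , cong suc (toℕ-fromℕ N)

threadBlock⇒layout : ∀ {N} {H : Graph N} {α β : Fin N} {σ : Fin N → Fin N} {lab : Fin N → Label} →
                     IsThreadBlock H α β σ lab → Layout H (λ _ → ⊤) α β
threadBlock⇒layout {N} {H} {α} {β} {σ} {lab} T = record
  { key           = key
  ; label         = lab
  ; start∈        = tt
  ; end∈          = tt
  ; key-injective = λ _ _ eq → index-injective (toℕ-injective eq)
  ; start-least   = λ _ → start-least
  ; end-greatest  = λ _ → end-greatest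
  ; label-start   = labFirst
  ; label-end     = labLast
  ; adjacency     = λ {x} {y} _ _ kx<ky → subst₂ (λ x y → E H x y ≡ hasR (lab x) ∧ hasL (lab y))
                                            (σ-index x) (σ-index y) (adjacency (index x) (index y) kx<ky)
  }
  where
  open IsThreadBlock T
  index : Fin N → Fin N
  index x = proj₁ (proj₂ ordering x)
  σ-index : ∀ x → σ (index x) ≡ x
  σ-index x = proj₂ (proj₂ ordering x) refl
  index-injective : ∀ {x y} → index x ≡ index y → x ≡ y
  index-injective {x} {y} eq = trans (sym (σ-index x)) (trans (cong σ eq) (σ-index y))
  index-of : ∀ {i x} → σ i ≡ x → index x ≡ i
  index-of σi≡x = proj₁ ordering (trans (σ-index _) (sym σi≡x))
  key : Fin N → ℕ
  key x = toℕ (index x)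
  key-start : key α ≡ 0
  key-start with i , i≡0 ← index-zero α = trans (cong toℕ (index-of (first i i≡0))) i≡0
  key-end : suc (key β) ≡ N
  key-end with i , i≡N-1 ← index-last β = trans (cong (suc ∘ toℕ) (index-of (last i i≡N-1))) i≡N-1
  start-least : ∀ {x} → x ≢ α → key α < key x
  start-least {x} x≢α = subst (_< key x) (sym key-start)
    (n≢0⇒n>0 (λ kx≡0 → x≢α (trans (sym (σ-index x)) (first _ kx≡0))))
  end-greatest : ∀ {x} → x ≢ β → key x < key β
  end-greatest {x} x≢β = ≤∧≢⇒< (s≤s⁻¹ (subst (key x <_) (sym key-end) (toℕ<n (index x))))
    (λ kx≡kβ → x≢β (trans (sym (σ-index x)) (last _ (trans (cong suc kx≡kβ) key-end))))

Image : ∀ {N n} → (Fin N → Fin n) → Fin n → Set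
Image φ p = ∃ λ x → φ x ≡ p

module _ {N n : ℕ} {H : Graph N} {G : Graph n} {φ : Fin N → Fin n}
         (φ-injective : Injective _≡_ _≡_ φ) (φ-edges : ∀ x y → E G (φ x) (φ y) ≡ E H x y) where

  transport : ∀ {α β} → Layout H (λ _ → ⊤) α β → Layout G (Image φ) (φ α) (φ β)
  transport {α} {β} L = record
    { key           = key ∘ preimage
    ; label         = label ∘ preimage
    ; start∈        = α , refl
    ; end∈          = β , refl
    ; key-injective = λ { (x , refl) (y , refl) eq →
                          cong φ (key-injective tt tt (subst₂ _≡_ (key-φ x) (key-φ y) eq)) }
    ; start-least   = λ { (x , refl) φx≢φα → subst₂ _<_ (sym (key-φ α)) (sym (key-φ x))
                                                         (start-least tt (φx≢φα ∘ cong φ)) }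
    ; end-greatest  = λ { (x , refl) φx≢φβ → subst₂ _<_ (sym (key-φ x)) (sym (key-φ β))
                                                         (end-greatest tt (φx≢φβ ∘ cong φ)) }
    ; label-start   = trans (label-φ α) label-start
    ; label-end     = trans (label-φ β) label-end
    ; adjacency     = λ { (x , refl) (y , refl) lt → begin
        E G (φ x) (φ y)                   ≡⟨ φ-edges x y ⟩
        E H x y                           ≡⟨ adjacency tt tt (subst₂ _<_ (key-φ x) (key-φ y) lt) ⟩
        hasR (label x) ∧ hasL (label y)   ≡⟨ sym (cong₂ (λ l l′ → hasR l ∧ hasL l′)
                                                         (label-φ x) (label-φ y)) ⟩
        hasR (label (preimage (φ x))) ∧ hasL (label (preimage (φ y))) ∎ }
    }
    where
    open Layout L
    open ≡-Reasoning
    -- vertices outside the image get the key and label of α; they are not in the domain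
    preimage : Fin n → Fin N
    preimage p with any? (λ x → φ x ≟ᶠ p)
    ... | yes (x , _) = x
    ... | no _        = α
    preimage-φ : ∀ x → preimage (φ x) ≡ x
    preimage-φ x with any? (λ y → φ y ≟ᶠ φ x)
    ... | yes (y , φy≡φx) = φ-injective φy≡φx
    ... | no miss         = contradiction (x , refl) miss
    key-φ : ∀ x → key (preimage (φ x)) ≡ key x
    key-φ x = cong key (preimage-φ x)
    label-φ : ∀ x → label (preimage (φ x)) ≡ label x
    label-φ x = cong label (preimage-φ x)

-- Chains of thread blocks

record BlockChain {n : ℕ} (G : Graph n) : Set₁ where
  field
    m               : ℕ
    size            : Fin m → ℕ
    block           : (t : Fin m) → Graph (size t)
    start end       : (t : Fin m) → Fin (size t)
    order           : (t : Fin m) → Fin (size t) → Fin (size t)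
    label           : (t : Fin m) → Fin (size t) → Label
    isBlock         : (t : Fin m) → IsThreadBlock (block t) (start t) (end t) (order t) (label t)
    embed           : (t : Fin m) → Fin (size t) → Fin n
    embed-injective : ∀ t → Injective _≡_ _≡_ (embed t)
    glued           : ∀ {t s} {x : Fin (size t)} {y : Fin (size s)} → t ≢ s → embed t x ≡ embed s y →
                      (toℕ s ≡ suc (toℕ t) × x ≡ end t × y ≡ start s) ⊎
                      (toℕ t ≡ suc (toℕ s) × x ≡ start t × y ≡ end s)
    linked          : ∀ {t s} → toℕ s ≡ suc (toℕ t) → embed t (end t) ≡ embed s (start s)
    lift-edge       : ∀ {t x q} → Adj G (embed t x) q →
                      Σ (Fin m) λ s → Σ (Fin (size s)) λ x′ → Σ (Fin (size s)) λ y′ →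
                        embed s x′ ≡ embed t x × embed s y′ ≡ q × Adj (block s) x′ y′
    embed-edge      : ∀ {t x y} → Adj (block t) x y → Adj G (embed t x) (embed t y)

  InBlock : Fin m → Fin n → Set
  InBlock t = Image (embed t)

  InSomeBlock : Fin n → Set
  InSomeBlock p = ∃ λ t → InBlock t p

module BlockChainProperties {n : ℕ} {G : Graph n} (C : BlockChain G) where

  open BlockChain C

  shared-index : ∀ {t s x y} → embed t x ≡ embed s y →
                 toℕ s ≤ toℕ t ⊎ (toℕ s ≡ suc (toℕ t) × x ≡ end t)
  shared-index {t} {s} eq with t ≟ᶠ s
  ... | yes refl = inj₁ ≤-refl
  ... | no t≢s with glued t≢s eq
  ...   | inj₁ (s≡1+t , x≡end , _) = inj₂ (s≡1+t , x≡end)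
  ...   | inj₂ (t≡1+s , _ , _)     = inj₁ (≤-trans (n≤1+n _) (≤-reflexive (sym t≡1+s)))

  shared-is-end : ∀ {t s x y} → t ≢ s → embed t x ≡ embed s y →
                  embed t x ≡ embed t (start t) ⊎ embed t x ≡ embed t (end t)
  shared-is-end t≢s eq with glued t≢s eq
  ... | inj₁ (_ , x≡end , _)   = inj₂ (cong (embed _) x≡end)
  ... | inj₂ (_ , x≡start , _) = inj₁ (cong (embed _) x≡start)

  private
    no-2-cycle : ∀ {i j} → i ≡ suc j → j ≢ suc i
    no-2-cycle {i} i≡1+j j≡1+i = <⇒≢ (m<n⇒m<1+n (n<1+n i)) (trans i≡1+j (cong suc j≡1+i))

  at-most-one-shared : ∀ {t s x x′ y y′} → t ≢ s →
                       embed t x ≡ embed s y → embed t x′ ≡ embed s y′ → x ≡ x′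
  at-most-one-shared t≢s eq eq′ with glued t≢s eq | glued t≢s eq′
  ... | inj₁ (_ , x≡end , _)   | inj₁ (_ , x′≡end , _)   = trans x≡end (sym x′≡end)
  ... | inj₂ (_ , x≡start , _) | inj₂ (_ , x′≡start , _) = trans x≡start (sym x′≡start)
  ... | inj₁ (s≡1+t , _ , _)   | inj₂ (t≡1+s , _ , _)    = contradiction s≡1+t (no-2-cycle t≡1+s)
  ... | inj₂ (t≡1+s , _ , _)   | inj₁ (s≡1+t , _ , _)    = contradiction s≡1+t (no-2-cycle t≡1+s)

  embed-adjacency : ∀ t x y → E G (embed t x) (embed t y) ≡ E (block t) x y
  embed-adjacency t x y with E (block t) x y in x~y
  ... | true  = embed-edge x~y
  ... | false = ¬-not not-adjacent
    where
    not-adjacent : ¬ Adj G (embed t x) (embed t y)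
    not-adjacent φx~φy with s , x′ , y′ , ex , ey , x′~y′ ← lift-edge φx~φy with s ≟ᶠ t
    ... | yes refl = contradiction
      (trans (sym x′~y′) (trans (cong₂ (E (block t)) (embed-injective t ex) (embed-injective t ey)) x~y))
      (λ ())
    ... | no s≢t   = adjacent⇒distinct (block s) x′~y′ (at-most-one-shared s≢t ex ey)

  block-layout : ∀ t → Layout G (InBlock t) (embed t (start t)) (embed t (end t))
  block-layout t = transport (embed-injective t) (embed-adjacency t) (threadBlock⇒layout (isBlock t))

  step-in-some-block : ∀ {p q} → Adj G p q → InSomeBlock p → InSomeBlock q
  step-in-some-block p~q (t , x , refl) with s , _ , y′ , _ , ey , _ ← lift-edge p~q = s , y′ , ey

  -- Deleting w, the end of the block with index c ∸ 1, separates the blocks before c from the rest.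
  module Cut (c : ℕ) (w : Fin n) (w-glue : ∀ {t} → suc (toℕ t) ≡ c → embed t (end t) ≡ w) where

    Before : Fin n → Set
    Before p = ∃ λ t → toℕ t < c × InBlock t p

    before-step : ∀ {p q} → Adj G p q → p ≢ w → Before p → Before q
    before-step p~q p≢w (t , t<c , x , refl) with s , x′ , y′ , ex , ey , _ ← lift-edge p~q
      with shared-index (sym ex)
    ... | inj₁ s≤t = s , ≤-<-trans s≤t t<c , y′ , ey
    ... | inj₂ (s≡1+t , x≡end) with m≤n⇒m<n∨m≡n t<c
    ...   | inj₁ 1+t<c = s , subst (_< c) (sym s≡1+t) 1+t<c , y′ , ey
    ...   | inj₂ 1+t≡c = contradiction (trans (cong (embed t) x≡end) (w-glue 1+t≡c)) p≢w

    before∧after⇒cut : ∀ {p s} → Before p → InBlock s p → c ≤ toℕ s → p ≡ w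
    before∧after⇒cut (t , t<c , x , refl) (y , ey) c≤s with shared-index (sym ey)
    ... | inj₁ s≤t             = contradiction (≤-<-trans s≤t t<c) (≤⇒≯ c≤s)
    ... | inj₂ (s≡1+t , x≡end) = trans (cong (embed t) x≡end)
                                       (w-glue (≤-antisym t<c (subst (c ≤_) s≡1+t c≤s)))

  module _ {S : Fin n → Set} {F : Fin n → Fin n → Set} (F⊆G : ∀ {x y} → F x y → Adj G x y)
           (S-2conn : TwoConnected S F) where

    open TwoConnected S-2conn

    cut-separates : ∀ c w (w-glue : ∀ {t} → suc (toℕ t) ≡ c → embed t (end t) ≡ w) {p q s} →
                    S p → S q → p ≢ w → q ≢ w → Cut.Before c w w-glue p → InBlock s q → c ≤ toℕ s → ⊥
    cut-separates c w w-glue {p} {q} Sp Sq p≢w q≢w p-before q∈s c≤s =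
      q≢w (before∧after⇒cut (proj₁ (walk-preserves _ closed p⇝q (p-before , p≢w))) q∈s c≤s)
      where
      open Cut c w w-glue
      p⇝q : Walk (λ r → S r × r ∉ w ∷ []) F p q
      p⇝q = robust (w ∷ []) (s≤s (s≤s z≤n)) p q (Sp , ≢⇒∉[ w ] p≢w) (Sq , ≢⇒∉[ w ] q≢w)
      closed : ∀ {r r′} → F r r′ → S r′ × r′ ∉ w ∷ [] → Before r × r ≢ w → Before r′ × r′ ≢ w
      closed f (_ , r′∉) (r-before , r≢w) = before-step (F⊆G f) r≢w r-before , λ r′≡w → r′∉ (here r′≡w)

    two-connected⊆block : ∀ {t} → (∀ w → ∃ λ p → (S p × InBlock t p) × p ≢ w) →
                          ∀ {z} → S z → InBlock t z
    two-connected⊆block {t} avoiding {z} Sz with any? (λ x → embed t x ≟ᶠ z)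
    ... | yes z∈t = z∈t
    ... | no z∉t
      with x , (Sx , x∈t) , _ ← avoiding z
      with s , z∈s ← walk-preserves InSomeBlock (λ f _ → step-in-some-block (F⊆G f))
                       (robust [] (s≤s z≤n) x z (Sx , λ ()) (Sz , λ ())) (t , x∈t)
      with <-cmp (toℕ t) (toℕ s)
    ... | tri≈ _ t≡s _ = contradiction (subst (λ r → InBlock r z) (sym (toℕ-injective t≡s)) z∈s) z∉t
    ... | tri< t<s _ _ with p , (Sp , p∈t) , p≢w ← avoiding (embed t (end t)) =
      ⊥-elim $ cut-separates (suc (toℕ t)) _ w-glue Sp Sz p≢w z≢w (t , ≤-refl , p∈t) z∈s t<s
      where
      w-glue : ∀ {t′} → suc (toℕ t′) ≡ suc (toℕ t) → embed t′ (end t′) ≡ embed t (end t)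
      w-glue 1+t′≡1+t with refl ← toℕ-injective (suc-injective 1+t′≡1+t) = refl
      z≢w : z ≢ embed t (end t)
      z≢w z≡w = z∉t (end t , sym z≡w)
    ... | tri> _ _ s<t with p , (Sp , p∈t) , p≢w ← avoiding (embed t (start t)) =
      ⊥-elim $ cut-separates (toℕ t) _ (linked ∘ sym) Sz Sp z≢w p≢w (s , s<t , z∈s) p∈t ≤-refl
      where
      z≢w : z ≢ embed t (start t)
      z≢w z≡w = z∉t (start t , sym z≡w)

  pendant-neighbour-is-end : ∀ t {u a} → InBlock t a → Adj G u a → (∀ {q} → Adj G u q → q ≡ a) →
                             a ≡ embed t (start t) ⊎ a ≡ embed t (end t)
  pendant-neighbour-is-end t {u} (x , refl) u~a u-pendant with any? (λ x′ → embed t x′ ≟ᶠ u)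
  ... | yes u∈t with Layout.adjacent-to-an-end (block-layout t) u∈t
  ...   | inj₁ u~start = inj₁ (sym (u-pendant u~start))
  ...   | inj₂ u~end   = inj₂ (sym (u-pendant u~end))
  pendant-neighbour-is-end t {u} (x , refl) u~a u-pendant | no u∉t
    with s , x′ , y′ , ex , ey , _ ← lift-edge (trans (E-sym G _ u) u~a)
    with t ≟ᶠ s
  ... | yes refl = contradiction (y′ , ey) u∉t
  ... | no t≢s   = shared-is-end t≢s (sym ex)

-- Thread graphs

gluing-chain : ∀ {n} {G : Graph n} (T : ThreadGraph G) (j : Fin (ThreadGraph.c T)) →
               ThreadGluing (ThreadGraph.comp T j) → BlockChain G
gluing-chain {n} {G} T j Gl = record
  { m               = Gl.m
  ; size            = Gl.size
  ; block           = Gl.block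
  ; start           = Gl.a
  ; end             = Gl.b
  ; order           = Gl.order
  ; label           = Gl.label
  ; isBlock         = Gl.isBlock
  ; embed           = embed
  ; embed-injective = embed-injective
  ; glued           = glued
  ; linked          = linked
  ; lift-edge       = lift-edge
  ; embed-edge      = embed-edge
  }
  where
  module T = ThreadGraph T
  module Gl = ThreadGluing Gl

  embed : (t : Fin Gl.m) → Fin (Gl.size t) → Fin n
  embed t = T.g j ∘ Gl.f t

  identified : ∀ {t s x y} → embed t x ≡ embed s y →
               _≡_ {A = Σ (Fin Gl.m) (λ l → Fin (Gl.size l))} (t , x) (s , y)
               ⊎ (toℕ s ≡ suc (toℕ t) × x ≡ Gl.b t × y ≡ Gl.a s)
               ⊎ (toℕ t ≡ suc (toℕ s) × x ≡ Gl.a t × y ≡ Gl.b s)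
  identified {t} {s} {x} {y} eq = Equivalence.to (Gl.ident t s x y)
    (,-injectiveʳ-UIP (Decidable⇒UIP.≡-irrelevant _≟ᶠ_) (T.inj j j (Gl.f t x) (Gl.f s y) eq))

  embed-injective : ∀ t → Injective _≡_ _≡_ (embed t)
  embed-injective t eq with identified eq
  ... | inj₁ tx≡ty                  = ,-injectiveʳ-UIP (Decidable⇒UIP.≡-irrelevant _≟ᶠ_) tx≡ty
  ... | inj₂ (inj₁ (t≡1+t , _ , _)) = contradiction (sym t≡1+t) 1+n≢n
  ... | inj₂ (inj₂ (t≡1+t , _ , _)) = contradiction (sym t≡1+t) 1+n≢n

  glued : ∀ {t s x y} → t ≢ s → embed t x ≡ embed s y →
          (toℕ s ≡ suc (toℕ t) × x ≡ Gl.b t × y ≡ Gl.a s) ⊎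
          (toℕ t ≡ suc (toℕ s) × x ≡ Gl.a t × y ≡ Gl.b s)
  glued t≢s eq with identified eq
  ... | inj₁ tx≡sy = contradiction (,-injectiveˡ tx≡sy) t≢s
  ... | inj₂ ends  = ends

  linked : ∀ {t s} → toℕ s ≡ suc (toℕ t) → embed t (Gl.b t) ≡ embed s (Gl.a s)
  linked {t} {s} s≡1+t =
    cong (T.g j) (Equivalence.from (Gl.ident t s _ _) (inj₂ (inj₁ (s≡1+t , refl , refl))))

  lift-edge : ∀ {t x q} → Adj G (embed t x) q →
              Σ (Fin Gl.m) λ s → Σ (Fin (Gl.size s)) λ x′ → Σ (Fin (Gl.size s)) λ y′ →
                embed s x′ ≡ embed t x × embed s y′ ≡ q × Adj (Gl.block s) x′ y′
  lift-edge {t} {x} {q} φx~q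
    with j′ , p , p′ , ep , ep′ , p~p′ ← Equivalence.to (T.edges _ q) φx~q
    with refl ← T.inj j′ j p (Gl.f t x) ep
    with s , x′ , y′ , ex , ey , x′~y′ ← Equivalence.to (Gl.edges p p′) p~p′
    = s , x′ , y′ , cong (T.g j) ex , trans (cong (T.g j) ey) ep′ , x′~y′

  embed-edge : ∀ {t x y} → Adj (Gl.block t) x y → Adj G (embed t x) (embed t y)
  embed-edge {t} {x} {y} x~y = Equivalence.from (T.edges _ _)
    (j , Gl.f t x , Gl.f t y , refl , refl ,
     Equivalence.from (Gl.edges _ _) (t , x , y , refl , refl , x~y))

chain-through-edge : ∀ {n} {G : Graph n} → ThreadGraph G → ∀ {x y} → Adj G x y →
                Σ (BlockChain G) λ C → Σ (Fin (BlockChain.m C)) λ t →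
                  BlockChain.InBlock C t x × BlockChain.InBlock C t y
chain-through-edge T {x} {y} x~y
  with j , x′ , y′ , ex , ey , x′~y′ ← Equivalence.to (ThreadGraph.edges T x y) x~y
  with ThreadGraph.isConn T j
... | inj₁ single =
  contradiction (one-vertex single x′ y′) (adjacent⇒distinct (ThreadGraph.comp T j) x′~y′)
  where
  one-vertex : ∀ {k} → k ≡ 1 → (p q : Fin k) → p ≡ q
  one-vertex refl zero zero = refl
... | inj₂ Gl
  with t , x″ , y″ , ex′ , ey′ , _ ← Equivalence.to (ThreadGluing.edges Gl x′ y′) x′~y′
  = gluing-chain T j Gl , t , (x″ , trans (cong (ThreadGraph.g T j) ex′) ex)
                            , (y″ , trans (cong (ThreadGraph.g T j) ey′) ey)

lemma13 : ∀ {n} (G : Graph n) → ThreadGraph G →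
          (S : Fin n → Set) (F : Fin n → Fin n → Set) →
          IsSubgraph G S F → TwoConnected S F →
          (u v : Fin n) → (∀ w → S w ⊎ (w ≡ u ⊎ w ≡ v)) →
          deg G u ≡ 1 → deg G v ≡ 1 →
          (a b : Fin n) → S a → S b → Adj G u a → Adj G v b → a ≢ b →
          Adj G a b ×
          Σ (Fin n → Fin n) (λ σ → Σ (Fin n → Label) (λ lab →
            IsThreadBlock G a b σ lab))
lemma13 G T S F G₀⊆G G₀-2conn u v cover deg-u deg-v a b Sa Sb u~a v~b a≢b
  with x , y , Sx , Sy , x~y ← edge-of-two-connected G₀-2conn
  with C , t , x∈t , y∈t ← chain-through-edge T (IsSubgraph.edgeIn G₀⊆G x y x~y)
  = Layout.adjacent-start-end layout
  , complete-with-pendants layout u~a u-pendant v~b v-pendant (λ w → map₁ S⊆t (cover w))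
  where
  open IsSubgraph G₀⊆G using (edgeIn)
  open BlockChain C using (InBlock)
  open BlockChainProperties C

  S⊆t : ∀ {z} → S z → InBlock t z
  S⊆t = two-connected⊆block (edgeIn _ _) G₀-2conn
          (one-avoids (Sx , x∈t) (Sy , y∈t) (adjacent⇒distinct G (edgeIn x y x~y)))

  u-pendant : ∀ {q} → Adj G u q → q ≡ a
  u-pendant = deg≡1⇒unique-neighbour G deg-u u~a

  v-pendant : ∀ {q} → Adj G v q → q ≡ b
  v-pendant = deg≡1⇒unique-neighbour G deg-v v~b

  layout : Layout G (InBlock t) a b
  layout = oriented (block-layout t) (pendant-neighbour-is-end t (S⊆t Sa) u~a u-pendant)
                                     (pendant-neighbour-is-end t (S⊆t Sb) v~b v-pendant) a≢b
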